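{- In an AL-monoid $A$, for all $a,b,c\in A$, $$a\ast b+b\ast c=(a\wedge c)\ast b+b\ast(a\vee c).$$
   Context: An AL-monoid (autometrized lattice ordered monoid) is an algebra $(A,+,\vee,\wedge,\ast,0)$ of type $(2,2,2,2,0)$ such that: (1) $(A,+,\vee,\wedge,0)$ is a commutative lattice ordered monoid, i.e. $(A,+,0)$ is a commutative monoid with identity $0$, $(A,\vee,\wedge)$ is a lattice with induced order $\leq$, and $a+(b\vee c)=(a+b)\vee(a+c)$, $a+(b\wedge c)=(a+b)\wedge(a+c)$; (2) $a\ast(a\wedge b)+b=a\vee b$ for all $a,b$; (3) for each $a\in A$ the maps $x\mapsto a+x$, $x\mapsto a\vee x$, $x\mapsto a\wedge x$, $x\mapsto a\ast x$ are contractions with respect to $\ast$, i.e. $f(x)\ast f(y)\leq x\ast y$ for all $x,y$; (4) $[a\ast(a\vee b)]\wedge[b\ast(a\vee b)]=0$ for all $a,b$; and $\ast$ is a metric operation: $a\ast b\geq 0$ with equality iff $a=b$, $a\ast b=b\ast a$, and $a\ast b\leq a\ast c+c\ast b$ for all $a,b,c$. -}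

module Defs where

open import Level using (Level; suc; _⊔_)
open import Relation.Binary.PropositionalEquality using (_≡_)
open import Algebra.Structures using (IsCommutativeMonoid)
open import Algebra.Lattice.Structures using (IsLattice)

record ALMonoid (c : Level) : Set (suc c) where
  infixl 6 _+_
  infixr 7 _∨_
  infixr 8 _∧_
  infix 9 _*_
  infix 4 _≤_
  field
    Carrier : Set c
    _+_ _∨_ _∧_ _*_ : Carrier → Carrier → Carrier
    0# : Carrier

  _≤_ : Carrier → Carrier → Set c
  x ≤ y = x ∧ y ≡ x

  field
    +-isCommutativeMonoid : IsCommutativeMonoid _≡_ _+_ 0#
    isLattice             : IsLattice _≡_ _∨_ _∧_
    +-distrib-∨ : ∀ a b c → a + (b ∨ c) ≡ (a + b) ∨ (a + c)
    +-distrib-∧ : ∀ a b c → a + (b ∧ c) ≡ (a + b) ∧ (a + c)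
    ax2 : ∀ a b → a * (a ∧ b) + b ≡ a ∨ b
    +-contr : ∀ a x y → (a + x) * (a + y) ≤ x * y
    ∨-contr : ∀ a x y → (a ∨ x) * (a ∨ y) ≤ x * y
    ∧-contr : ∀ a x y → (a ∧ x) * (a ∧ y) ≤ x * y
    *-contr : ∀ a x y → (a * x) * (a * y) ≤ x * y
    ax4 : ∀ a b → (a * (a ∨ b)) ∧ (b * (a ∨ b)) ≡ 0#
    *-nonneg : ∀ a b → 0# ≤ a * b
    *-zero⇒≡ : ∀ a b → a * b ≡ 0# → a ≡ b
    *-self   : ∀ a → a * a ≡ 0#
    *-comm   : ∀ a b → a * b ≡ b * a
    *-triangle : ∀ a b c → a * b ≤ a * c + c * b

-- Split the distance from x to b as x * b = b * (x ∧ b) + (x ∨ b) * b, the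
-- analogue of |x − b| = (x − b)⁻ + (x − b)⁺ in an ℓ-group.  The contraction
-- axioms make x ↦ (x ∨ b) * b monotone and x ↦ b * (x ∧ b) antitone, and
-- 1-Lipschitz for *; with the disjointness axiom (4) this upgrades them to a
-- lattice homomorphism and a lattice antihomomorphism.  Since
-- p + q = p ∧ q + p ∨ q, both are valuations, hence so is x ↦ x * b.

module Submission where

open import Defs
open import Level using (Level)
open import Data.Product using (_,_)
open import Relation.Binary.PropositionalEquality
  using (_≡_; sym; trans; cong; cong₂; isEquivalence; module ≡-Reasoning)
open import Algebra.Bundles using (CommutativeMonoid)
open import Algebra.Structures using (IsCommutativeMonoid)
open import Algebra.Lattice.Bundles using (Lattice)
open import Algebra.Lattice.Structures using (IsLattice)
import Algebra.Lattice.Properties.Lattice as LatticeProperties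
import Algebra.Properties.CommutativeSemigroup as CommutativeSemigroupProperties
import Relation.Binary.Lattice as Order
import Relation.Binary.Lattice.Properties.JoinSemilattice as JoinSemilatticeProperties
import Relation.Binary.Lattice.Properties.MeetSemilattice as MeetSemilatticeProperties
import Relation.Binary.Reasoning.PartialOrder as PartialOrderReasoning

module ALMonoidProperties {ℓ : Level} (A : ALMonoid ℓ) where
  open ALMonoid A
  open IsCommutativeMonoid +-isCommutativeMonoid
    using () renaming (assoc to +-assoc; comm to +-comm; identityʳ to +-identityʳ)
  open IsLattice isLattice using (∨-comm; ∧-comm)

  +-commutativeMonoid : CommutativeMonoid ℓ ℓ
  +-commutativeMonoid = record { isCommutativeMonoid = +-isCommutativeMonoid }

  open CommutativeSemigroupProperties (CommutativeMonoid.commutativeSemigroup +-commutativeMonoid)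
    using (interchange)

  lattice : Lattice ℓ ℓ
  lattice = record { isLattice = isLattice }

  open LatticeProperties lattice using (∨-idem)

  -- The library orders a lattice by x ≈ x ∧ y; the AL-monoid order is x ∧ y ≡ x.
  ≤-isLattice : Order.IsLattice _≡_ _≤_ _∨_ _∧_
  ≤-isLattice = record
    { isPartialOrder = record
        { isPreorder = record
            { isEquivalence = isEquivalence
            ; reflexive     = λ x≡y → sym (≼.reflexive x≡y)
            ; trans         = λ x≤y y≤z → sym (≼.trans (sym x≤y) (sym y≤z))
            }
        ; antisym = λ x≤y y≤x → ≼.antisym (sym x≤y) (sym y≤x)
        }
    ; supremum = λ x y → let ub₁ , ub₂ , least = ≼.supremum x y in
        sym ub₁ , sym ub₂ , λ z x≤z y≤z → sym (least z (sym x≤z) (sym y≤z))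
    ; infimum = λ x y → let lb₁ , lb₂ , greatest = ≼.infimum x y in
        sym lb₁ , sym lb₂ , λ z z≤x z≤y → sym (greatest z (sym z≤x) (sym z≤y))
    }
    where module ≼ = Order.IsLattice (LatticeProperties.∨-∧-isOrderTheoreticLattice lattice)

  ≤-lattice : Order.Lattice ℓ ℓ ℓ
  ≤-lattice = record { isLattice = ≤-isLattice }

  open Order.Lattice ≤-lattice
    using ( poset; joinSemilattice; meetSemilattice
          ; x≤x∨y; y≤x∨y; ∨-least; x∧y≤x; x∧y≤y; ∧-greatest)
    renaming (refl to ≤-refl; trans to ≤-trans; antisym to ≤-antisym)
  open JoinSemilatticeProperties joinSemilattice using (∨-monotonic; x≤y⇒x∨y≈y)
  open MeetSemilatticeProperties meetSemilattice using (∧-monotonic)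

  +-monoʳ-≤ : ∀ x {y z} → y ≤ z → x + y ≤ x + z
  +-monoʳ-≤ x {y} {z} y≤z = trans (sym (+-distrib-∧ x y z)) (cong (x +_) y≤z)

  +-monoˡ-≤ : ∀ x {y z} → y ≤ z → y + x ≤ z + x
  +-monoˡ-≤ x {y} {z} y≤z = trans (cong₂ _∧_ (+-comm y x) (+-comm z x))
                                  (trans (+-monoʳ-≤ x y≤z) (+-comm x y))

  +-distribʳ-∨ : ∀ x y z → (y ∨ z) + x ≡ (y + x) ∨ (z + x)
  +-distribʳ-∨ x y z = trans (+-comm (y ∨ z) x)
    (trans (+-distrib-∨ x y z) (cong₂ _∨_ (+-comm x y) (+-comm x z)))

  x≤y⇒y*x+x≡y : ∀ {x y} → x ≤ y → y * x + x ≡ y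
  x≤y⇒y*x+x≡y {x} {y} x≤y = begin
    y * x + x        ≡⟨ cong (λ w → y * w + x) (trans (∧-comm y x) x≤y) ⟨
    y * (y ∧ x) + x  ≡⟨ ax2 y x ⟩
    y ∨ x            ≡⟨ trans (∨-comm y x) (x≤y⇒x∨y≈y x≤y) ⟩
    y                ∎
    where open ≡-Reasoning

  0≤x⇒x*0≡x : ∀ {x} → 0# ≤ x → x * 0# ≡ x
  0≤x⇒x*0≡x {x} 0≤x = trans (sym (+-identityʳ (x * 0#))) (x≤y⇒y*x+x≡y 0≤x)

  x∧y+x∨y≡x+y : ∀ x y → x ∧ y + x ∨ y ≡ x + y
  x∧y+x∨y≡x+y x y = begin
    x ∧ y + x ∨ y                ≡⟨ cong (x ∧ y +_) (ax2 x y) ⟨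
    x ∧ y + (x * (x ∧ y) + y)    ≡⟨ +-assoc _ _ _ ⟨
    (x ∧ y + x * (x ∧ y)) + y    ≡⟨ cong (_+ y) (trans (+-comm _ _) (x≤y⇒y*x+x≡y (x∧y≤x x y))) ⟩
    x + y                        ∎
    where open ≡-Reasoning

  disjoint⇒+≡∨ : ∀ {x y} → 0# ≤ x → x ∧ y ≡ 0# → x + y ≡ x ∨ y
  disjoint⇒+≡∨ {x} {y} 0≤x x∧y≡0 = begin
    x + y                ≡⟨ cong (_+ y) (0≤x⇒x*0≡x 0≤x) ⟨
    x * 0# + y           ≡⟨ cong (λ w → x * w + y) x∧y≡0 ⟨
    x * (x ∧ y) + y      ≡⟨ ax2 x y ⟩
    x ∨ y                ∎
    where open ≡-Reasoning

  ∧-≤-disjoint : ∀ {x y z u v} → x ≤ z + u → y ≤ z + v → u ∧ v ≡ 0# → x ∧ y ≤ z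
  ∧-≤-disjoint {x} {y} {z} {u} {v} x≤z+u y≤z+v u∧v≡0 = begin
    x ∧ y              ≤⟨ ∧-monotonic x≤z+u y≤z+v ⟩
    (z + u) ∧ (z + v)  ≡⟨ +-distrib-∧ z u v ⟨
    z + u ∧ v          ≡⟨ cong (z +_) u∧v≡0 ⟩
    z + 0#             ≡⟨ +-identityʳ z ⟩
    z                  ∎
    where open PartialOrderReasoning poset

  [x∨y]*x≡y*[x∧y] : ∀ x y → (x ∨ y) * x ≡ y * (x ∧ y)
  [x∨y]*x≡y*[x∧y] x y = ≤-antisym ≤-direction ≥-direction
    where
    open PartialOrderReasoning poset
    s = x * (x ∧ y)
    ≤-direction : (x ∨ y) * x ≤ y * (x ∧ y)
    ≤-direction = begin
      (x ∨ y) * x            ≡⟨ cong₂ _*_ (ax2 x y) (x≤y⇒y*x+x≡y (x∧y≤x x y)) ⟨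
      (s + y) * (s + x ∧ y)  ≤⟨ +-contr s y (x ∧ y) ⟩
      y * (x ∧ y)            ∎
    ≥-direction : y * (x ∧ y) ≤ (x ∨ y) * x
    ≥-direction = begin
      y * (x ∧ y)              ≡⟨ cong₂ _*_ (y≤x∨y x y) (∧-comm y x) ⟨
      (y ∧ (x ∨ y)) * (y ∧ x)  ≤⟨ ∧-contr y (x ∨ y) x ⟩
      (x ∨ y) * x              ∎

  [x∨y]*y≡x*[x∧y] : ∀ x y → (x ∨ y) * y ≡ x * (x ∧ y)
  [x∨y]*y≡x*[x∧y] x y = begin
    (x ∨ y) * y  ≡⟨ cong (_* y) (∨-comm x y) ⟩
    (y ∨ x) * y  ≡⟨ [x∨y]*x≡y*[x∧y] y x ⟩
    x * (y ∧ x)  ≡⟨ cong (x *_) (∧-comm y x) ⟩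
    x * (x ∧ y)  ∎
    where open ≡-Reasoning

  [x∨y]*x∧[x∨y]*y≡0 : ∀ x y → (x ∨ y) * x ∧ (x ∨ y) * y ≡ 0#
  [x∨y]*x∧[x∨y]*y≡0 x y = trans (cong₂ _∧_ (*-comm _ x) (*-comm _ y)) (ax4 x y)

  x*[x∧y]∧y*[x∧y]≡0 : ∀ x y → x * (x ∧ y) ∧ y * (x ∧ y) ≡ 0#
  x*[x∧y]∧y*[x∧y]≡0 x y = begin
    x * (x ∧ y) ∧ y * (x ∧ y)  ≡⟨ cong₂ _∧_ ([x∨y]*y≡x*[x∧y] x y) ([x∨y]*x≡y*[x∧y] x y) ⟨
    (x ∨ y) * y ∧ (x ∨ y) * x  ≡⟨ ∧-comm _ _ ⟩
    (x ∨ y) * x ∧ (x ∨ y) * y  ≡⟨ [x∨y]*x∧[x∨y]*y≡0 x y ⟩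
    0#                         ∎
    where open ≡-Reasoning

  *≡[x∨y]*x+[x∨y]*y : ∀ x y → x * y ≡ (x ∨ y) * x + (x ∨ y) * y
  *≡[x∨y]*x+[x∨y]*y x y = ≤-antisym ≤-direction ≥-direction
    where
    open PartialOrderReasoning poset
    u = x ∨ y
    ≤-direction : x * y ≤ u * x + u * y
    ≤-direction = begin
      x * y          ≤⟨ *-triangle x y u ⟩
      x * u + u * y  ≡⟨ cong (_+ u * y) (*-comm x u) ⟩
      u * x + u * y  ∎
    u*x≤x*y : u * x ≤ x * y
    u*x≤x*y = begin
      u * x            ≡⟨ *-comm u x ⟩
      x * u            ≡⟨ cong (_* u) (∨-idem x) ⟨
      (x ∨ x) * u      ≤⟨ ∨-contr x x y ⟩
      x * y            ∎
    u*y≤x*y : u * y ≤ x * y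
    u*y≤x*y = begin
      u * y            ≡⟨ cong₂ _*_ (∨-comm y x) (∨-idem y) ⟨
      (y ∨ x) * (y ∨ y) ≤⟨ ∨-contr y x y ⟩
      x * y            ∎
    ≥-direction : u * x + u * y ≤ x * y
    ≥-direction = begin
      u * x + u * y  ≡⟨ disjoint⇒+≡∨ (*-nonneg u x) ([x∨y]*x∧[x∨y]*y≡0 x y) ⟩
      u * x ∨ u * y  ≤⟨ ∨-least u*x≤x*y u*y≤x*y ⟩
      x * y          ∎

  *-monoˡ-above : ∀ {t x y} → t ≤ x → x ≤ y → x * t ≤ y * t
  *-monoˡ-above {t} {x} {y} t≤x x≤y = begin
    x * t              ≡⟨ cong₂ _*_ x≤y (trans (∧-comm x t) t≤x) ⟨
    (x ∧ y) * (x ∧ t)  ≤⟨ ∧-contr x y t ⟩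
    y * t              ∎
    where open PartialOrderReasoning poset

  *-antiʳ-below : ∀ {t x y} → x ≤ y → y ≤ t → t * y ≤ t * x
  *-antiʳ-below {t} {x} {y} x≤y y≤t = begin
    t * y              ≡⟨ cong₂ _*_ (x≤y⇒x∨y≈y y≤t) (trans (∨-comm y x) (x≤y⇒x∨y≈y x≤y)) ⟨
    (y ∨ t) * (y ∨ x)  ≤⟨ ∨-contr y t x ⟩
    t * x              ∎
    where open PartialOrderReasoning poset

  [x+y]*y≤x : ∀ {x} y → 0# ≤ x → (x + y) * y ≤ x
  [x+y]*y≤x {x} y 0≤x = begin
    (x + y) * y        ≡⟨ cong₂ _*_ (+-comm y x) (+-identityʳ y) ⟨
    (y + x) * (y + 0#) ≤⟨ +-contr y x 0# ⟩
    x * 0#             ≡⟨ 0≤x⇒x*0≡x 0≤x ⟩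
    x                  ∎
    where open PartialOrderReasoning poset

  x≤z+t⇒x*t≤z : ∀ {x z t} → t ≤ x → x ≤ z + t → 0# ≤ z → x * t ≤ z
  x≤z+t⇒x*t≤z {t = t} t≤x x≤z+t 0≤z = ≤-trans (*-monoˡ-above t≤x x≤z+t) ([x+y]*y≤x t 0≤z)

  infix 9 _*⁺_ _*⁻_

  _*⁺_ _*⁻_ : Carrier → Carrier → Carrier
  x *⁺ b = (x ∨ b) * b
  x *⁻ b = b * (x ∧ b)

  *≡*⁻+*⁺ : ∀ x b → x * b ≡ x *⁻ b + x *⁺ b
  *≡*⁻+*⁺ x b = trans (*≡[x∨y]*x+[x∨y]*y x b) (cong (_+ x *⁺ b) ([x∨y]*x≡y*[x∧y] x b))

  *⁺+b≡∨ : ∀ x b → x *⁺ b + b ≡ x ∨ b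
  *⁺+b≡∨ x b = x≤y⇒y*x+x≡y (y≤x∨y x b)

  *⁻+∧≡b : ∀ x b → x *⁻ b + x ∧ b ≡ b
  *⁻+∧≡b x b = x≤y⇒y*x+x≡y (x∧y≤y x b)

  *⁺-monoˡ : ∀ b {x y} → x ≤ y → x *⁺ b ≤ y *⁺ b
  *⁺-monoˡ b {x} x≤y = *-monoˡ-above (y≤x∨y x b) (∨-monotonic x≤y ≤-refl)

  *⁻-antiˡ : ∀ b {x y} → x ≤ y → y *⁻ b ≤ x *⁻ b
  *⁻-antiˡ b {y = y} x≤y = *-antiʳ-below (∧-monotonic x≤y ≤-refl) (x∧y≤y y b)

  *⁺-lipschitz : ∀ b x w → x *⁺ b ≤ w *⁺ b + x * w
  *⁺-lipschitz b x w = begin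
    (x ∨ b) * b                 ≤⟨ *-triangle (x ∨ b) b (w ∨ b) ⟩
    (x ∨ b) * (w ∨ b) + w *⁺ b  ≡⟨ cong (_+ w *⁺ b) (cong₂ _*_ (∨-comm x b) (∨-comm w b)) ⟩
    (b ∨ x) * (b ∨ w) + w *⁺ b  ≤⟨ +-monoˡ-≤ (w *⁺ b) (∨-contr b x w) ⟩
    x * w + w *⁺ b              ≡⟨ +-comm _ _ ⟩
    w *⁺ b + x * w              ∎
    where open PartialOrderReasoning poset

  *⁻-lipschitz : ∀ b x w → x *⁻ b ≤ w *⁻ b + w * x
  *⁻-lipschitz b x w = begin
    b * (x ∧ b)                 ≤⟨ *-triangle b (x ∧ b) (w ∧ b) ⟩
    w *⁻ b + (w ∧ b) * (x ∧ b)  ≡⟨ cong (w *⁻ b +_) (cong₂ _*_ (∧-comm w b) (∧-comm x b)) ⟩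
    w *⁻ b + (b ∧ w) * (b ∧ x)  ≤⟨ +-monoʳ-≤ (w *⁻ b) (∧-contr b w x) ⟩
    w *⁻ b + w * x              ∎
    where open PartialOrderReasoning poset

  *⁺-∨ : ∀ b x y → (x ∨ y) *⁺ b ≡ x *⁺ b ∨ y *⁺ b
  *⁺-∨ b x y = ≤-antisym ≤-direction
    (∨-least (*⁺-monoˡ b (x≤x∨y x y)) (*⁺-monoˡ b (y≤x∨y x y)))
    where
    open PartialOrderReasoning poset
    z = x *⁺ b ∨ y *⁺ b
    bound : (x ∨ y) ∨ b ≤ z + b
    bound = begin
      (x ∨ y) ∨ b
        ≤⟨ ∨-least (∨-monotonic (x≤x∨y x b) (x≤x∨y y b)) (≤-trans (y≤x∨y x b) (x≤x∨y _ _)) ⟩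
      (x ∨ b) ∨ (y ∨ b)
        ≡⟨ cong₂ _∨_ (*⁺+b≡∨ x b) (*⁺+b≡∨ y b) ⟨
      (x *⁺ b + b) ∨ (y *⁺ b + b)
        ≡⟨ +-distribʳ-∨ b _ _ ⟨
      z + b
        ∎
    ≤-direction : (x ∨ y) *⁺ b ≤ z
    ≤-direction = x≤z+t⇒x*t≤z (y≤x∨y (x ∨ y) b) bound (≤-trans (*-nonneg _ _) (x≤x∨y _ _))

  *⁻-∧ : ∀ b x y → (x ∧ y) *⁻ b ≡ x *⁻ b ∨ y *⁻ b
  *⁻-∧ b x y = ≤-antisym ≤-direction
    (∨-least (*⁻-antiˡ b (x∧y≤x x y)) (*⁻-antiˡ b (x∧y≤y x y)))
    where
    open PartialOrderReasoning poset
    z = x *⁻ b ∨ y *⁻ b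
    b≤z+w∧b : ∀ {w} → w *⁻ b ≤ z → b ≤ z + w ∧ b
    b≤z+w∧b {w} w*⁻b≤z = begin
      b                  ≡⟨ *⁻+∧≡b w b ⟨
      w *⁻ b + w ∧ b     ≤⟨ +-monoˡ-≤ (w ∧ b) w*⁻b≤z ⟩
      z + w ∧ b          ∎
    bound : b ≤ z + (x ∧ y) ∧ b
    bound = begin
      b
        ≤⟨ ∧-greatest (b≤z+w∧b (x≤x∨y _ _)) (b≤z+w∧b (y≤x∨y _ _)) ⟩
      (z + x ∧ b) ∧ (z + y ∧ b)
        ≡⟨ +-distrib-∧ z _ _ ⟨
      z + (x ∧ b) ∧ (y ∧ b)
        ≤⟨ +-monoʳ-≤ z (∧-greatest (∧-monotonic (x∧y≤x x b) (x∧y≤x y b))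
                                   (≤-trans (x∧y≤y (x ∧ b) (y ∧ b)) (x∧y≤y y b))) ⟩
      z + (x ∧ y) ∧ b
        ∎
    ≤-direction : (x ∧ y) *⁻ b ≤ z
    ≤-direction = x≤z+t⇒x*t≤z (x∧y≤y (x ∧ y) b) bound (≤-trans (*-nonneg _ _) (x≤x∨y _ _))

  *⁺-∧ : ∀ b x y → (x ∧ y) *⁺ b ≡ x *⁺ b ∧ y *⁺ b
  *⁺-∧ b x y = ≤-antisym (∧-greatest (*⁺-monoˡ b (x∧y≤x x y)) (*⁺-monoˡ b (x∧y≤y x y)))
    (∧-≤-disjoint (*⁺-lipschitz b x (x ∧ y)) (*⁺-lipschitz b y (x ∧ y)) (x*[x∧y]∧y*[x∧y]≡0 x y))

  *⁻-∨ : ∀ b x y → (x ∨ y) *⁻ b ≡ x *⁻ b ∧ y *⁻ b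
  *⁻-∨ b x y = ≤-antisym (∧-greatest (*⁻-antiˡ b (x≤x∨y x y)) (*⁻-antiˡ b (y≤x∨y x y)))
    (∧-≤-disjoint (*⁻-lipschitz b x (x ∨ y)) (*⁻-lipschitz b y (x ∨ y)) ([x∨y]*x∧[x∨y]*y≡0 x y))

  *⁺-valuation : ∀ b x y → x *⁺ b + y *⁺ b ≡ (x ∧ y) *⁺ b + (x ∨ y) *⁺ b
  *⁺-valuation b x y = begin
    x *⁺ b + y *⁺ b                          ≡⟨ x∧y+x∨y≡x+y _ _ ⟨
    x *⁺ b ∧ y *⁺ b + x *⁺ b ∨ y *⁺ b        ≡⟨ cong₂ _+_ (*⁺-∧ b x y) (*⁺-∨ b x y) ⟨
    (x ∧ y) *⁺ b + (x ∨ y) *⁺ b              ∎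
    where open ≡-Reasoning

  *⁻-valuation : ∀ b x y → x *⁻ b + y *⁻ b ≡ (x ∧ y) *⁻ b + (x ∨ y) *⁻ b
  *⁻-valuation b x y = begin
    x *⁻ b + y *⁻ b                          ≡⟨ x∧y+x∨y≡x+y _ _ ⟨
    x *⁻ b ∧ y *⁻ b + x *⁻ b ∨ y *⁻ b        ≡⟨ cong₂ _+_ (*⁻-∨ b x y) (*⁻-∧ b x y) ⟨
    (x ∨ y) *⁻ b + (x ∧ y) *⁻ b              ≡⟨ +-comm _ _ ⟩
    (x ∧ y) *⁻ b + (x ∨ y) *⁻ b              ∎
    where open ≡-Reasoning

  *-valuation : ∀ b x y → x * b + y * b ≡ (x ∧ y) * b + (x ∨ y) * b
  *-valuation b x y = begin
    x * b + y * b
      ≡⟨ cong₂ _+_ (*≡*⁻+*⁺ x b) (*≡*⁻+*⁺ y b) ⟩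
    (x *⁻ b + x *⁺ b) + (y *⁻ b + y *⁺ b)
      ≡⟨ interchange _ _ _ _ ⟩
    (x *⁻ b + y *⁻ b) + (x *⁺ b + y *⁺ b)
      ≡⟨ cong₂ _+_ (*⁻-valuation b x y) (*⁺-valuation b x y) ⟩
    ((x ∧ y) *⁻ b + (x ∨ y) *⁻ b) + ((x ∧ y) *⁺ b + (x ∨ y) *⁺ b)
      ≡⟨ interchange _ _ _ _ ⟩
    ((x ∧ y) *⁻ b + (x ∧ y) *⁺ b) + ((x ∨ y) *⁻ b + (x ∨ y) *⁺ b)
      ≡⟨ cong₂ _+_ (*≡*⁻+*⁺ (x ∧ y) b) (*≡*⁻+*⁺ (x ∨ y) b) ⟨
    (x ∧ y) * b + (x ∨ y) * b
      ∎
    where open ≡-Reasoning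

mainTheorem8 : ∀ {c : Level} (A : ALMonoid c) → let open ALMonoid A in
    ∀ a b d → a * b + b * d ≡ (a ∧ d) * b + b * (a ∨ d)
mainTheorem8 A a b d = begin
  a * b + b * d                  ≡⟨ cong (a * b +_) (*-comm b d) ⟩
  a * b + d * b                  ≡⟨ *-valuation b a d ⟩
  (a ∧ d) * b + (a ∨ d) * b      ≡⟨ cong ((a ∧ d) * b +_) (*-comm (a ∨ d) b) ⟩
  (a ∧ d) * b + b * (a ∨ d)      ∎
  where
  open ALMonoid A
  open ALMonoidProperties A using (*-valuation)
  open ≡-Reasoning
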